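{- Let ${\sf V}$ be a quantale, $X$ a set, and $c:{\sf P}X\to{\sf V}^X$ a map. The following are equivalent: (i) $c$ is a ${\sf V}$-valued closure space structure on $X$, i.e. (R) ${\sf k}\le (cA)(x)$ whenever $x\in A\subseteq X$, and (T) $\big(\bigwedge_{y\in B}(cA)(y)\big)\otimes (cB)(x)\le (cA)(x)$ for all $A,B\subseteq X$, $x\in X$; (ii) $c_{\rm disc}A\le cA$ and $[c_{\rm disc}B,cA]\le[cB,cA]$ for all $A,B\subseteq X$; (iii) $[c_{\rm disc}B,cA]=[cB,cA]$ for all $A,B\subseteq X$.
   Context: A quantale ${\sf V}=({\sf V},\otimes,{\sf k})$ is a complete lattice with a (not necessarily commutative) monoid structure $(\otimes,{\sf k})$ such that $\otimes$ preserves arbitrary suprema in each variable. ${\sf P}X$ is the power set of $X$; ${\sf V}^X$ is the set of maps $X\to{\sf V}$, ordered pointwise. For $v,w\in{\sf V}$, $[v,w]\in{\sf V}$ is defined by $u\le[v,w]\iff u\otimes v\le w$ for all $u$ (so $[v,-]$ is right adjoint to $(-)\otimes v$). For $\sigma,\tau\in{\sf V}^X$, $[\sigma,\tau]=\bigwedge_{x\in X}[\sigma(x),\tau(x)]$. The map $c_{\rm disc}:{\sf P}X\to{\sf V}^X$ is given by $(c_{\rm disc}A)(x)={\sf k}$ if $x\in A$ and $\bot$ otherwise. -}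

module Defs where

open import Level using (0ℓ)
open import Data.Product using (Σ; _×_; _,_; proj₁)
open import Relation.Binary.PropositionalEquality using (_≡_)
open import Relation.Binary.Structures using (IsPartialOrder)
open import Relation.Unary using (Pred; _∈_)

record Quantale : Set₁ where
  infixr 7 _⊗_
  infix 4 _≤_
  field
    Carrier : Set
    _≤_ : Carrier → Carrier → Set
    isPartialOrder : IsPartialOrder _≡_ _≤_
    ⋁ : {I : Set} → (I → Carrier) → Carrier
    ⋁-upper : {I : Set} (f : I → Carrier) (i : I) → f i ≤ ⋁ f
    ⋁-least : {I : Set} (f : I → Carrier) (u : Carrier) →
              ((i : I) → f i ≤ u) → ⋁ f ≤ u
    _⊗_ : Carrier → Carrier → Carrier
    k : Carrier
    ⊗-assoc : ∀ u v w → (u ⊗ v) ⊗ w ≡ u ⊗ (v ⊗ w)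
    ⊗-identityˡ : ∀ u → k ⊗ u ≡ u
    ⊗-identityʳ : ∀ u → u ⊗ k ≡ u
    ⊗-⋁ˡ : ∀ {I : Set} (u : Carrier) (f : I → Carrier) →
           u ⊗ ⋁ f ≡ ⋁ (λ i → u ⊗ f i)
    ⊗-⋁ʳ : ∀ {I : Set} (f : I → Carrier) (u : Carrier) →
           ⋁ f ⊗ u ≡ ⋁ (λ i → f i ⊗ u)

  ⋀ : {I : Set} → (I → Carrier) → Carrier
  ⋀ {I} f = ⋁ {Σ Carrier (λ u → (i : I) → u ≤ f i)} proj₁

  -- [v , w] : the right adjoint of (-) ⊗ v, u ≤ [v,w] iff u ⊗ v ≤ w
  [_,_] : Carrier → Carrier → Carrier
  [ v , w ] = ⋁ {Σ Carrier (λ u → u ⊗ v ≤ w)} proj₁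

module _ (V : Quantale) (X : Set) where
  open Quantale V

  𝒫 : Set₁
  𝒫 = Pred X 0ℓ

  [_,_]ₓ : (X → Carrier) → (X → Carrier) → Carrier
  [ σ , τ ]ₓ = ⋀ (λ x → [ σ x , τ x ])

  _≤ₓ_ : (X → Carrier) → (X → Carrier) → Set
  σ ≤ₓ τ = ∀ x → σ x ≤ τ x

  -- (c_disc A)(x) = k if x ∈ A, ⊥ otherwise; written as the supremum of
  -- the constant family k indexed by proofs of x ∈ A
  c-disc : 𝒫 → X → Carrier
  c-disc A x = ⋁ {x ∈ A} (λ _ → k)

  IsClosure : (𝒫 → X → Carrier) → Set₁
  IsClosure c =
    (∀ (A : 𝒫) (x : X) → x ∈ A → k ≤ c A x) ×
    (∀ (A B : 𝒫) (x : X) →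
       ⋀ {Σ X (λ y → y ∈ B)} (λ y → c A (proj₁ y)) ⊗ c B x ≤ c A x)

  CondII : (𝒫 → X → Carrier) → Set₁
  CondII c =
    (∀ (A : 𝒫) → c-disc A ≤ₓ c A) ×
    (∀ (A B : 𝒫) → [ c-disc B , c A ]ₓ ≤ [ c B , c A ]ₓ)

  CondIII : (𝒫 → X → Carrier) → Set₁
  CondIII c = ∀ (A B : 𝒫) → [ c-disc B , c A ]ₓ ≡ [ c B , c A ]ₓ

-- Both (R) and (T) are statements about c in terms of the residuals [-,-]ₓ once
-- one notices that [c_disc B , τ] is the infimum of τ over B, since u ≤ [c_disc B , τ]
-- says exactly that u ≤ τ y for every y ∈ B.  Thus (R) is c_disc A ≤ cA, and (T) is
-- [c_disc B , cA] ≤ [cB , cA].  Given (R), the reverse inequality in (iii) holds because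
-- [-, cA] is antitone; conversely (iii) with B = A gives k ≤ [cA , cA] = [c_disc A , cA],
-- which is (R).
module Submission where

open import Defs
open import Data.Bool using (true; false; if_then_else_)
open import Data.Product using (Σ; _×_; _,_; proj₁; proj₂)
open import Data.Product.Function.NonDependent.Propositional using (_×-⇔_)
open import Function.Bundles using (_⇔_; mk⇔; Equivalence)
open import Relation.Binary.Bundles using (Poset)
open import Relation.Binary.PropositionalEquality using (_≡_; sym; cong)
open import Relation.Binary.Structures using (IsPartialOrder)
open import Relation.Unary using (_∈_)

open Equivalence using (to; from)

module QuantaleProperties (V : Quantale) where
  open Quantale V
  open IsPartialOrder isPartialOrder public
    using (antisym; trans; reflexive) renaming (refl to ≤-refl)

  poset : Poset _ _ _
  poset = record { isPartialOrder = isPartialOrder }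

  open import Relation.Binary.Reasoning.PartialOrder poset

  ⋀-lower : {I : Set} (f : I → Carrier) (i : I) → ⋀ f ≤ f i
  ⋀-lower f i = ⋁-least proj₁ (f i) (λ u → proj₂ u i)

  ⋀-greatest : {I : Set} (f : I → Carrier) (u : Carrier) →
               ((i : I) → u ≤ f i) → u ≤ ⋀ f
  ⋀-greatest f u u≤f = ⋁-upper proj₁ (u , u≤f)

  _∨_ : Carrier → Carrier → Carrier
  a ∨ b = ⋁ (λ i → if i then a else b)

  ≤⇒∨≡ : ∀ {a b} → a ≤ b → a ∨ b ≡ b
  ≤⇒∨≡ {a} {b} a≤b =
    antisym (⋁-least _ b λ { true → a≤b ; false → ≤-refl }) (⋁-upper _ false)

  ⊗-monoˡ : ∀ {a b} v → a ≤ b → a ⊗ v ≤ b ⊗ v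
  ⊗-monoˡ {a} {b} v a≤b = begin
    a ⊗ v                                  ≤⟨ ⋁-upper _ true ⟩
    ⋁ (λ i → (if i then a else b) ⊗ v)     ≡⟨ sym (⊗-⋁ʳ _ v) ⟩
    (a ∨ b) ⊗ v                            ≡⟨ cong (_⊗ v) (≤⇒∨≡ a≤b) ⟩
    b ⊗ v                                  ∎

  ⊗-monoʳ : ∀ {a b} v → a ≤ b → v ⊗ a ≤ v ⊗ b
  ⊗-monoʳ {a} {b} v a≤b = begin
    v ⊗ a                                  ≤⟨ ⋁-upper _ true ⟩
    ⋁ (λ i → v ⊗ (if i then a else b))     ≡⟨ sym (⊗-⋁ˡ v _) ⟩
    v ⊗ (a ∨ b)                            ≡⟨ cong (v ⊗_) (≤⇒∨≡ a≤b) ⟩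
    v ⊗ b                                  ∎

  residual-eval : ∀ v w → [ v , w ] ⊗ v ≤ w
  residual-eval v w = begin
    [ v , w ] ⊗ v             ≡⟨ ⊗-⋁ʳ proj₁ v ⟩
    ⋁ (λ u → proj₁ u ⊗ v)     ≤⟨ ⋁-least _ w proj₂ ⟩
    w                         ∎

  ≤-residual⇔ : ∀ {u v w} → u ≤ [ v , w ] ⇔ u ⊗ v ≤ w
  ≤-residual⇔ {u} {v} {w} = mk⇔
    (λ u≤[v,w] → trans (⊗-monoˡ v u≤[v,w]) (residual-eval v w))
    (λ u⊗v≤w → ⋁-upper proj₁ (u , u⊗v≤w))

module FunctionSpaceProperties (V : Quantale) (X : Set) where
  open Quantale V
  open QuantaleProperties V

  ≤-[,]ₓ⇔ : ∀ {u} {σ τ : X → Carrier} →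
            u ≤ [_,_]ₓ V X σ τ ⇔ (∀ x → u ⊗ σ x ≤ τ x)
  ≤-[,]ₓ⇔ = mk⇔
    (λ u≤[σ,τ] x → to ≤-residual⇔ (trans u≤[σ,τ] (⋀-lower _ x)))
    (λ u⊗σ≤τ → ⋀-greatest _ _ λ x → from ≤-residual⇔ (u⊗σ≤τ x))

  ⊗-c-disc≤⇔ : ∀ {u v} {A : 𝒫 V X} {x} → u ⊗ c-disc V X A x ≤ v ⇔ (x ∈ A → u ≤ v)
  ⊗-c-disc≤⇔ {u} {v} {A} {x} = mk⇔
    (λ u⊗cA≤v x∈A → begin
      u                           ≡⟨ sym (⊗-identityʳ u) ⟩
      u ⊗ k                       ≤⟨ ⋁-upper _ x∈A ⟩
      ⋁ (λ (_ : x ∈ A) → u ⊗ k)   ≡⟨ sym (⊗-⋁ˡ u _) ⟩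
      u ⊗ c-disc V X A x          ≤⟨ u⊗cA≤v ⟩
      v                           ∎)
    (λ u≤v → begin
      u ⊗ c-disc V X A x          ≡⟨ ⊗-⋁ˡ u _ ⟩
      ⋁ (λ (_ : x ∈ A) → u ⊗ k)   ≤⟨ ⋁-least _ v (λ x∈A → trans (reflexive (⊗-identityʳ u)) (u≤v x∈A)) ⟩
      v                           ∎)
    where open import Relation.Binary.Reasoning.PartialOrder poset

  ≤-[c-disc,]ₓ⇔ : ∀ {u} {B : 𝒫 V X} {τ : X → Carrier} →
                  u ≤ [_,_]ₓ V X (c-disc V X B) τ ⇔ (∀ y → y ∈ B → u ≤ τ y)
  ≤-[c-disc,]ₓ⇔ {B = B} = mk⇔
    (λ u≤[B,τ] y → to (⊗-c-disc≤⇔ {A = B}) (to ≤-[,]ₓ⇔ u≤[B,τ] y))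
    (λ u≤τ → from ≤-[,]ₓ⇔ λ y → from (⊗-c-disc≤⇔ {A = B}) (u≤τ y))

  [c-disc,]ₓ≡⋀ : ∀ (B : 𝒫 V X) (τ : X → Carrier) →
                 [_,_]ₓ V X (c-disc V X B) τ ≡ ⋀ {Σ X (_∈ B)} (λ y → τ (proj₁ y))
  [c-disc,]ₓ≡⋀ B τ = antisym
    (⋀-greatest _ _ λ (y , y∈B) → to ≤-[c-disc,]ₓ⇔ ≤-refl y y∈B)
    (from ≤-[c-disc,]ₓ⇔ λ y y∈B → ⋀-lower _ (y , y∈B))

  c-disc≤ₓ⇔ : ∀ {A : 𝒫 V X} {τ : X → Carrier} →
              _≤ₓ_ V X (c-disc V X A) τ ⇔ (∀ x → x ∈ A → k ≤ τ x)
  c-disc≤ₓ⇔ = mk⇔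
    (λ A≤τ x x∈A → trans (⋁-upper _ x∈A) (A≤τ x))
    (λ k≤τ x → ⋁-least _ _ (k≤τ x))

  [,]ₓ-antitoneˡ : ∀ {σ σ′ τ : X → Carrier} →
                   _≤ₓ_ V X σ σ′ → [_,_]ₓ V X σ′ τ ≤ [_,_]ₓ V X σ τ
  [,]ₓ-antitoneˡ σ≤σ′ = from ≤-[,]ₓ⇔ λ x →
    trans (⊗-monoʳ _ (σ≤σ′ x)) (to ≤-[,]ₓ⇔ ≤-refl x)

  k≤[σ,σ]ₓ : ∀ (σ : X → Carrier) → k ≤ [_,_]ₓ V X σ σ
  k≤[σ,σ]ₓ σ = from ≤-[,]ₓ⇔ λ x → reflexive (⊗-identityˡ (σ x))

module ClosureSpaceConditions (V : Quantale) (X : Set)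
                              (c : 𝒫 V X → X → Quantale.Carrier V) where
  open Quantale V
  open QuantaleProperties V
  open FunctionSpaceProperties V X

  reflexivity⇔c-disc≤ₓ : (∀ A x → x ∈ A → k ≤ c A x) ⇔
                         (∀ A → _≤ₓ_ V X (c-disc V X A) (c A))
  reflexivity⇔c-disc≤ₓ = mk⇔ (λ R A → from c-disc≤ₓ⇔ (R A))
                             (λ c-disc≤c A → to c-disc≤ₓ⇔ (c-disc≤c A))

  transitivity⇔[c-disc,]ₓ≤[c,]ₓ :
    (∀ A B x → ⋀ {Σ X (_∈ B)} (λ y → c A (proj₁ y)) ⊗ c B x ≤ c A x) ⇔
    (∀ A B → [_,_]ₓ V X (c-disc V X B) (c A) ≤ [_,_]ₓ V X (c B) (c A))
  transitivity⇔[c-disc,]ₓ≤[c,]ₓ = mk⇔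
    (λ T A B → trans (reflexive ([c-disc,]ₓ≡⋀ B (c A))) (from ≤-[,]ₓ⇔ (T A B)))
    (λ t A B → to ≤-[,]ₓ⇔ (trans (reflexive (sym ([c-disc,]ₓ≡⋀ B (c A)))) (t A B)))

  IsClosure⇔CondII : IsClosure V X c ⇔ CondII V X c
  IsClosure⇔CondII = reflexivity⇔c-disc≤ₓ ×-⇔ transitivity⇔[c-disc,]ₓ≤[c,]ₓ

  CondII⇔CondIII : CondII V X c ⇔ CondIII V X c
  CondII⇔CondIII = mk⇔
    (λ (c-disc≤c , t) A B → antisym (t A B) ([,]ₓ-antitoneˡ (c-disc≤c B)))
    (λ e → (λ A → from c-disc≤ₓ⇔ (to ≤-[c-disc,]ₓ⇔
                    (trans (k≤[σ,σ]ₓ (c A)) (reflexive (sym (e A A))))))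
         , (λ A B → reflexive (e A B)))

proposition5p1 : (V : Quantale) (X : Set) (c : 𝒫 V X → X → Quantale.Carrier V) →
    (IsClosure V X c ⇔ CondII V X c) × (CondII V X c ⇔ CondIII V X c)
proposition5p1 V X c = IsClosure⇔CondII , CondII⇔CondIII
  where open ClosureSpaceConditions V X c
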